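{- Let $n\ge 3$ and $1\le k<n$ be integers with $\gcd(n,k)=1$. Then ${D^\ast}^k_n={D^\ast}_n$, i.e. the number of permutations $p$ of $[n]$ with $p(i+1)\not\equiv p(i)+k\pmod n$ for all $1\le i\le n-1$ and $p(1)\not\equiv p(n)+k\pmod n$ equals the number of permutations $p$ of $[n]$ with $p(i+1)\not\equiv p(i)+1\pmod n$ for all $1\le i\le n-1$ and $p(1)\not\equiv p(n)+1\pmod n$.
   Context: Permutations of $[n]=\{1,\dots,n\}$ are in one-line notation $p=p(1)\cdots p(n)$. ${D^\ast}^k_n$ denotes the number of permutations of $[n]$ with no circular $k$-succession modulo $n$, as described in the claim, and ${D^\ast}_n={D^\ast}^1_n$. -}

module Defs where

open import Data.Nat using (ℕ; zero; suc; _+_; _%_; NonZero)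
open import Data.Fin using (Fin; toℕ; _≟_)
open import Data.Fin.Properties using (all?; any?)
open import Data.List using (List; []; _∷_; length; filter; concatMap; map; allFin)
open import Data.Product using (_×_; ∃)
open import Relation.Nullary using (¬_; Dec; yes; no)
open import Relation.Nullary.Decidable using (_×-dec_; _→-dec_; ¬?)
open import Relation.Binary.PropositionalEquality using (_≡_)
import Data.Nat as ℕ
import Data.Fin as F

-- [n] is modelled as Fin n = {0,…,n-1} (values and positions shifted by one;
-- this does not affect congruences mod n).

allFuns : (m n : ℕ) → List (Fin m → Fin n)
allFuns zero n = (λ ()) ∷ [] 
allFuns (suc m) n =
  concatMap (λ f → map (λ x → cons x f) (allFin n)) (allFuns m n)
  where
    cons : Fin n → (Fin m → Fin n) → Fin (suc m) → Fin n
    cons x f F.zero = x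
    cons x f (F.suc i) = f i

IsPerm : (n : ℕ) → (Fin n → Fin n) → Set
IsPerm n p = (∀ i j → p i ≡ p j → i ≡ j) × (∀ y → ∃ λ x → p x ≡ y)

isPerm? : (n : ℕ) (p : Fin n → Fin n) → Dec (IsPerm n p)
isPerm? n p = all? (λ i → all? (λ j → (p i ≟ p j) →-dec (i ≟ j)))
              ×-dec all? (λ y → any? (λ x → p x ≟ y))

-- b ≡ a + k (mod n), for a, b ∈ Fin n; with toℕ b < n this is b = (a + k) mod n.
-- Stated for n = suc m so that the modulus is nonzero.
KSucc : (m k : ℕ) → Fin (suc m) → Fin (suc m) → Set
KSucc m k a b = toℕ b ≡ (toℕ a + k) % suc m

kSucc? : (m k : ℕ) (a b : Fin (suc m)) → Dec (KSucc m k a b)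
kSucc? m k a b = toℕ b ℕ.≟ (toℕ a + k) % suc m

NoCircSucc : (m k : ℕ) → (Fin (suc m) → Fin (suc m)) → Set
NoCircSucc m k p =
  (∀ (i : Fin m) → ¬ KSucc m k (p (F.inject₁ i)) (p (F.suc i)))
  × ¬ KSucc m k (p (F.fromℕ m)) (p F.zero)

noCircSucc? : (m k : ℕ) (p : Fin (suc m) → Fin (suc m)) → Dec (NoCircSucc m k p)
noCircSucc? m k p =
  all? (λ i → ¬? (kSucc? m k (p (F.inject₁ i)) (p (F.suc i))))
  ×-dec ¬? (kSucc? m k (p (F.fromℕ m)) p0)
  where p0 = p F.zero

-- Counted as the number of functions Fin n → Fin n (each listed exactly once)
-- which are bijections and have no circular k-succession.
Dstar : (k n : ℕ) → ℕ
Dstar k zero = 1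
Dstar k (suc m) =
  length (filter (λ p → isPerm? (suc m) p ×-dec noCircSucc? m k p) (allFuns (suc m) (suc m)))

-- Since gcd n k = 1, multiplication by k is a bijection σ of ℤ/n sending b ≡ a + 1
-- to σ b ≡ σ a + k, so p ↦ σ ∘ p maps the permutations of [n] without circular
-- 1-succession bijectively onto those without circular k-succession.  For the count,
-- a sum over the enumeration of all functions Fin m → Fin n is unchanged by
-- post-composition with σ: by induction on m, each layer of the enumeration is a sum
-- over Fin n, which σ only reorders.

module Submission where

open import Defs
open import Data.Nat using (ℕ; _≤_; _<_)
open import Data.Nat.GCD using (gcd)
open import Relation.Binary.PropositionalEquality using (_≡_)

import Algebra.Properties.CommutativeMonoid.Sum as CommutativeMonoidSum
open import Data.Bool using (Bool; true; false)
open import Data.Fin using (Fin; toℕ; zero; suc)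
open import Data.Fin.Permutation using (Permutation′; permutation; _⟨$⟩ʳ_; _⟨$⟩ˡ_; inverseˡ; inverseʳ)
open import Data.Fin.Properties using (toℕ-fromℕ<; toℕ-injective; toℕ<n)
open import Data.List using (List; []; _∷_; _++_; length; filter; concatMap; map; allFin; tabulate)
open import Data.List.Properties using (map-cong; map-∘; map-++; map-tabulate; filter-≐)
open import Data.Nat using (NonZero; zero; suc; _+_; _*_; _%_)
open import Data.Nat.Coprimality using (gcd≡1⇒coprime; coprime-Bézout)
open import Data.Nat.DivMod using (_mod_; %-distribˡ-+; %-distribˡ-*; m%n%n≡m%n; [m+n]%n≡m%n; [m+kn]%n≡m%n; m<n⇒m%n≡m)
open import Data.Nat.GCD using (module Bézout)
open import Data.Nat.ListAction using (sum)
open import Data.Nat.ListAction.Properties using (sum-++)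
open import Data.Nat.Properties using (+-0-commutativeMonoid; +-comm; *-comm; *-assoc; *-identityˡ; *-identityʳ; *-distribˡ-+)
open import Data.Nat.Solver using (module +-*-Solver)
open import Data.Product using (∃; _,_; _×_; map₂)
open import Data.Vec.Functional using () renaming (_∷_ to _∷ᵛ_)
open import Data.Vec.Functional.Properties using (∷-cong)
open import Function using (_∘_; id; _⇔_; mk⇔; Equivalence)
open import Relation.Binary.Core using (_Preserves_⟶_)
open import Relation.Binary.Definitions using (_Respects_)
open import Relation.Binary.PropositionalEquality using (refl; sym; trans; cong; subst; subst₂; _≗_; module ≡-Reasoning)
open import Relation.Nullary using (does)
open import Relation.Nullary.Decidable using (does-⇔; _×-dec_)
open import Relation.Unary using (Pred; Decidable)

private
  variable
    A B : Set

sumBy : (A → ℕ) → List A → ℕ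
sumBy w xs = sum (map w xs)

sumBy-cong : {w v : A → ℕ} → w ≗ v → sumBy w ≗ sumBy v
sumBy-cong w≗v xs = cong sum (map-cong w≗v xs)

sumBy-map : (w : B → ℕ) (f : A → B) → sumBy w ∘ map f ≗ sumBy (w ∘ f)
sumBy-map w f xs = cong sum (sym (map-∘ xs))

sumBy-concatMap : (w : B → ℕ) (g : A → List B) → sumBy w ∘ concatMap g ≗ sumBy (sumBy w ∘ g)
sumBy-concatMap w g [] = refl
sumBy-concatMap w g (x ∷ xs) = begin
  sum (map w (g x ++ concatMap g xs))          ≡⟨ cong sum (map-++ w (g x) (concatMap g xs)) ⟩
  sum (map w (g x) ++ map w (concatMap g xs))  ≡⟨ sum-++ (map w (g x)) _ ⟩
  sumBy w (g x) + sumBy w (concatMap g xs)     ≡⟨ cong (sumBy w (g x) +_) (sumBy-concatMap w g xs) ⟩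
  sumBy w (g x) + sumBy (sumBy w ∘ g) xs       ∎
  where open ≡-Reasoning

indicator : Bool → ℕ
indicator true  = 1
indicator false = 0

length-filter≡sumBy : ∀ {ℓ} {P : Pred A ℓ} (P? : Decidable P) →
                      length ∘ filter P? ≗ sumBy (λ x → indicator (does (P? x)))
length-filter≡sumBy P? [] = refl
length-filter≡sumBy P? (x ∷ xs) with does (P? x)
... | true  = cong suc (length-filter≡sumBy P? xs)
... | false = length-filter≡sumBy P? xs

open CommutativeMonoidSum +-0-commutativeMonoid using (sum-permute) renaming (sum to ∑)

sum-tabulate : ∀ n (w : Fin n → ℕ) → sum (tabulate w) ≡ ∑ w
sum-tabulate zero    w = refl
sum-tabulate (suc n) w = cong (w zero +_) (sum-tabulate n (w ∘ suc))

sumBy-allFin-permute : ∀ {n} (π : Permutation′ n) (w : Fin n → ℕ) →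
                       sumBy (w ∘ (π ⟨$⟩ʳ_)) (allFin n) ≡ sumBy w (allFin n)
sumBy-allFin-permute {n} π w = begin
  sumBy (w ∘ (π ⟨$⟩ʳ_)) (allFin n)  ≡⟨ cong sum (map-tabulate id (w ∘ (π ⟨$⟩ʳ_))) ⟩
  sum (tabulate (w ∘ (π ⟨$⟩ʳ_)))    ≡⟨ sum-tabulate n _ ⟩
  ∑ (w ∘ (π ⟨$⟩ʳ_))                 ≡⟨ sum-permute w π ⟨
  ∑ w                               ≡⟨ sum-tabulate n w ⟨
  sum (tabulate w)                  ≡⟨ cong sum (map-tabulate id w) ⟨
  sumBy w (allFin n)                ∎
  where open ≡-Reasoning

-- allFuns builds its functions with a local cons that agrees with _∷ᵛ_ only
-- pointwise, hence the hypothesis that w respects _≗_.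
sumBy-allFuns-suc : ∀ m n (w : (Fin (suc m) → Fin n) → ℕ) → w Preserves _≗_ ⟶ _≡_ →
  sumBy w (allFuns (suc m) n) ≡ sumBy (λ f → sumBy (λ x → w (x ∷ᵛ f)) (allFin n)) (allFuns m n)
sumBy-allFuns-suc m n w w-resp =
  trans (sumBy-concatMap w _ (allFuns m n))
        (sumBy-cong (λ f → trans (sumBy-map w _ (allFin n))
                                 (sumBy-cong (λ x → w-resp (∷-cong refl λ _ → refl)) (allFin n)))
                    (allFuns m n))

module _ {n} (π : Permutation′ n) where

  private
    σ : Fin n → Fin n
    σ = π ⟨$⟩ʳ_

  sumBy-allFuns-∘ : ∀ m (w : (Fin m → Fin n) → ℕ) → w Preserves _≗_ ⟶ _≡_ →
                    sumBy w (allFuns m n) ≡ sumBy (w ∘ (σ ∘_)) (allFuns m n)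
  sumBy-allFuns-∘ zero    w w-resp = cong (_+ 0) (w-resp λ ())
  sumBy-allFuns-∘ (suc m) w w-resp = begin
    sumBy w (allFuns (suc m) n)
      ≡⟨ sumBy-allFuns-suc m n w w-resp ⟩
    sumBy (λ f → sumBy (λ x → w (x ∷ᵛ f)) (allFin n)) (allFuns m n)
      ≡⟨ sumBy-allFuns-∘ m _ layer-resp ⟩
    sumBy (λ f → sumBy (λ x → w (x ∷ᵛ σ ∘ f)) (allFin n)) (allFuns m n)
      ≡⟨ sumBy-cong (λ f → sumBy-allFin-permute π (λ x → w (x ∷ᵛ σ ∘ f))) (allFuns m n) ⟨
    sumBy (λ f → sumBy (λ x → w (σ x ∷ᵛ σ ∘ f)) (allFin n)) (allFuns m n)
      ≡⟨ sumBy-cong (λ f → sumBy-cong (λ x → w-resp (∷-cong refl λ _ → refl)) (allFin n)) (allFuns m n) ⟩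
    sumBy (λ f → sumBy (λ x → w (σ ∘ (x ∷ᵛ f))) (allFin n)) (allFuns m n)
      ≡⟨ sumBy-allFuns-suc m n (w ∘ (σ ∘_)) (λ f≗g → w-resp (cong σ ∘ f≗g)) ⟨
    sumBy (w ∘ (σ ∘_)) (allFuns (suc m) n)
      ∎
    where
    open ≡-Reasoning
    layer-resp : (λ f → sumBy (λ x → w (x ∷ᵛ f)) (allFin n)) Preserves _≗_ ⟶ _≡_
    layer-resp f≗g = sumBy-cong (λ x → w-resp (∷-cong refl f≗g)) (allFin n)

  count-allFuns-∘ : ∀ {m ℓ} {P : Pred (Fin m → Fin n) ℓ} (P? : Decidable P) → P Respects _≗_ →
    length (filter P? (allFuns m n)) ≡ length (filter (P? ∘ (σ ∘_)) (allFuns m n))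
  count-allFuns-∘ {m} P? P-resp = begin
    length (filter P? (allFuns m n))                   ≡⟨ length-filter≡sumBy P? (allFuns m n) ⟩
    sumBy (λ f → indicator (does (P? f))) (allFuns m n)   ≡⟨ sumBy-allFuns-∘ m _ indicator-resp ⟩
    sumBy (λ f → indicator (does (P? (σ ∘ f)))) (allFuns m n) ≡⟨ length-filter≡sumBy (P? ∘ (σ ∘_)) (allFuns m n) ⟨
    length (filter (P? ∘ (σ ∘_)) (allFuns m n))       ∎
    where
    open ≡-Reasoning
    indicator-resp : (λ f → indicator (does (P? f))) Preserves _≗_ ⟶ _≡_
    indicator-resp f≗g = cong indicator (does-⇔ (mk⇔ (P-resp f≗g) (P-resp (sym ∘ f≗g))) (P? _) (P? _))

module _ {d : ℕ} .{{_ : NonZero d}} where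

  %-absorbˡ-+ : ∀ x y → (x % d + y) % d ≡ (x + y) % d
  %-absorbˡ-+ x y = begin
    (x % d + y) % d          ≡⟨ %-distribˡ-+ (x % d) y d ⟩
    (x % d % d + y % d) % d  ≡⟨ cong (λ z → (z + y % d) % d) (m%n%n≡m%n x d) ⟩
    (x % d + y % d) % d      ≡⟨ %-distribˡ-+ x y d ⟨
    (x + y) % d              ∎
    where open ≡-Reasoning

  %-absorbʳ-+ : ∀ x y → (x + y % d) % d ≡ (x + y) % d
  %-absorbʳ-+ x y = begin
    (x + y % d) % d  ≡⟨ cong (_% d) (+-comm x (y % d)) ⟩
    (y % d + x) % d  ≡⟨ %-absorbˡ-+ y x ⟩
    (y + x) % d      ≡⟨ cong (_% d) (+-comm y x) ⟩
    (x + y) % d      ∎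
    where open ≡-Reasoning

  %-absorbʳ-* : ∀ c x → (c * (x % d)) % d ≡ (c * x) % d
  %-absorbʳ-* c x = begin
    (c * (x % d)) % d            ≡⟨ %-distribˡ-* c (x % d) d ⟩
    (c % d * (x % d % d)) % d    ≡⟨ cong (λ z → (c % d * z) % d) (m%n%n≡m%n x d) ⟩
    (c % d * (x % d)) % d        ≡⟨ %-distribˡ-* c x d ⟨
    (c * x) % d                  ∎
    where open ≡-Reasoning

  scale : ℕ → Fin d → Fin d
  scale c a = (c * toℕ a) mod d

  toℕ-scale : ∀ c a → toℕ (scale c a) ≡ (c * toℕ a) % d
  toℕ-scale c a = toℕ-fromℕ< _

  scale-inverse : ∀ c c' → (c * c') % d ≡ 1 % d → ∀ a → scale c (scale c' a) ≡ a
  scale-inverse c c' cc'≡1 a = toℕ-injective (begin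
    toℕ (scale c (scale c' a))       ≡⟨ toℕ-scale c _ ⟩
    (c * toℕ (scale c' a)) % d       ≡⟨ cong (λ z → (c * z) % d) (toℕ-scale c' a) ⟩
    (c * ((c' * toℕ a) % d)) % d     ≡⟨ %-absorbʳ-* c _ ⟩
    (c * (c' * toℕ a)) % d           ≡⟨ cong (_% d) (*-assoc c c' (toℕ a)) ⟨
    (c * c' * toℕ a) % d             ≡⟨ %-distribˡ-* (c * c') (toℕ a) d ⟩
    ((c * c') % d * (toℕ a % d)) % d ≡⟨ cong (λ z → (z * (toℕ a % d)) % d) cc'≡1 ⟩
    (1 % d * (toℕ a % d)) % d        ≡⟨ %-distribˡ-* 1 (toℕ a) d ⟨
    (1 * toℕ a) % d                  ≡⟨ cong (_% d) (*-identityˡ (toℕ a)) ⟩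
    toℕ a % d                        ≡⟨ m<n⇒m%n≡m (toℕ<n a) ⟩
    toℕ a                            ∎)
    where open ≡-Reasoning

module _ {m : ℕ} where

  KSucc-scale : ∀ c {j a b} → KSucc m j a b → KSucc m (c * j) (scale c a) (scale c b)
  KSucc-scale c {j} {a} {b} b≡a+j = begin
    toℕ (scale c b)                    ≡⟨ toℕ-scale c b ⟩
    (c * toℕ b) % suc m                ≡⟨ cong (λ z → (c * z) % suc m) b≡a+j ⟩
    (c * ((toℕ a + j) % suc m)) % suc m ≡⟨ %-absorbʳ-* c _ ⟩
    (c * (toℕ a + j)) % suc m          ≡⟨ cong (_% suc m) (*-distribˡ-+ c (toℕ a) j) ⟩
    (c * toℕ a + c * j) % suc m        ≡⟨ %-absorbˡ-+ (c * toℕ a) (c * j) ⟨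
    ((c * toℕ a) % suc m + c * j) % suc m ≡⟨ cong (λ z → (z + c * j) % suc m) (toℕ-scale c a) ⟨
    (toℕ (scale c a) + c * j) % suc m  ∎
    where open ≡-Reasoning

  KSucc-resp-% : ∀ {j j' a b} → j % suc m ≡ j' % suc m → KSucc m j a b → KSucc m j' a b
  KSucc-resp-% {j} {j'} {a} {b} j≡j' b≡a+j = begin
    toℕ b                          ≡⟨ b≡a+j ⟩
    (toℕ a + j) % suc m            ≡⟨ %-absorbʳ-+ (toℕ a) j ⟨
    (toℕ a + j % suc m) % suc m    ≡⟨ cong (λ z → (toℕ a + z) % suc m) j≡j' ⟩
    (toℕ a + j' % suc m) % suc m   ≡⟨ %-absorbʳ-+ (toℕ a) j' ⟩
    (toℕ a + j') % suc m           ∎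
    where open ≡-Reasoning

  KSucc-scale-⇔ : ∀ k k' → (k' * k) % suc m ≡ 1 % suc m → ∀ a b →
                  KSucc m 1 a b ⇔ KSucc m k (scale k a) (scale k b)
  KSucc-scale-⇔ k k' k'k≡1 a b = mk⇔
    (subst (λ c → KSucc m c (scale k a) (scale k b)) (*-identityʳ k) ∘ KSucc-scale k)
    (KSucc-resp-% {a = a} {b} k'k≡1 ∘ subst₂ (KSucc m (k' * k)) (unscale a) (unscale b) ∘ KSucc-scale k')
    where
    unscale : ∀ x → scale k' (scale k x) ≡ x
    unscale = scale-inverse k' k k'k≡1

  NoCircSucc-transfer : ∀ {j k} {p q : Fin (suc m) → Fin (suc m)} →
    (∀ {x y} → KSucc m k (q x) (q y) → KSucc m j (p x) (p y)) →
    NoCircSucc m j p → NoCircSucc m k q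
  NoCircSucc-transfer reflect (no-succ , no-wrap) = (λ i → no-succ i ∘ reflect) , no-wrap ∘ reflect

  NoCircSucc-resp-≗ : ∀ {k} → NoCircSucc m k Respects _≗_
  NoCircSucc-resp-≗ {k} p≗q = NoCircSucc-transfer λ {x y} → subst₂ (KSucc m k) (sym (p≗q x)) (sym (p≗q y))

IsPerm-resp-≗ : ∀ {n} → IsPerm n Respects _≗_
IsPerm-resp-≗ p≗q (injective , surjective) =
  (λ i j qi≡qj → injective i j (trans (p≗q i) (trans qi≡qj (sym (p≗q j))))) ,
  (λ y → map₂ (trans (sym (p≗q _))) (surjective y))

IsPerm-∘-⇔ : ∀ {n} (π : Permutation′ n) {p : Fin n → Fin n} → IsPerm n p ⇔ IsPerm n ((π ⟨$⟩ʳ_) ∘ p)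
IsPerm-∘-⇔ π {p} = mk⇔
  (λ (injective , surjective) →
    (λ i j → injective i j ∘ π-injective) ,
    (λ y → map₂ (λ px≡π⁻¹y → trans (cong (π ⟨$⟩ʳ_) px≡π⁻¹y) (inverseʳ π)) (surjective (π ⟨$⟩ˡ y))))
  (λ (injective , surjective) →
    (λ i j → injective i j ∘ cong (π ⟨$⟩ʳ_)) ,
    (λ y → map₂ π-injective (surjective (π ⟨$⟩ʳ y))))
  where
  π-injective : ∀ {x y} → π ⟨$⟩ʳ x ≡ π ⟨$⟩ʳ y → x ≡ y
  π-injective {x} {y} πx≡πy = trans (sym (inverseˡ π)) (trans (cong (π ⟨$⟩ˡ_) πx≡πy) (inverseˡ π))

modular-inverse : ∀ n .{{_ : NonZero n}} k → gcd n k ≡ 1 → ∃ λ k' → (k' * k) % n ≡ 1 % n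
modular-inverse (suc d) k gcd≡1 with coprime-Bézout (gcd≡1⇒coprime gcd≡1)
... | Bézout.-+ x y 1+xn≡yk = y , (begin
  (y * k) % suc d          ≡⟨ cong (_% suc d) 1+xn≡yk ⟨
  (1 + x * suc d) % suc d  ≡⟨ [m+kn]%n≡m%n 1 x (suc d) ⟩
  1 % suc d                ∎)
  where open ≡-Reasoning
-- Here k' = (n − 1) y ≡ − y (mod n).
... | Bézout.+- x y 1+yk≡xn = d * y , (begin
  (d * y * k) % suc d              ≡⟨ [m+n]%n≡m%n (d * y * k) (suc d) ⟨
  (d * y * k + suc d) % suc d      ≡⟨ cong (_% suc d) (shift d y k) ⟩
  (1 + d * (1 + y * k)) % suc d    ≡⟨ cong (λ z → (1 + d * z) % suc d) 1+yk≡xn ⟩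
  (1 + d * (x * suc d)) % suc d    ≡⟨ cong (λ z → (1 + z) % suc d) (*-assoc d x (suc d)) ⟨
  (1 + d * x * suc d) % suc d      ≡⟨ [m+kn]%n≡m%n 1 (d * x) (suc d) ⟩
  1 % suc d                        ∎)
  where
  open ≡-Reasoning
  open +-*-Solver
  shift : ∀ d y k → d * y * k + suc d ≡ 1 + d * (1 + y * k)
  shift = solve 3 (λ d y k → d :* y :* k :+ (con 1 :+ d) := con 1 :+ d :* (con 1 :+ y :* k)) refl

scale-permutation : ∀ {n} .{{_ : NonZero n}} k k' → (k' * k) % n ≡ 1 % n → Permutation′ n
scale-permutation {n} k k' k'k≡1 = permutation (scale k) (scale k')
  (scale-inverse k k' (subst (λ c → c % n ≡ 1 % n) (*-comm k' k) k'k≡1))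
  (scale-inverse k' k k'k≡1)

Dstar-resp-permutation : ∀ m j k (π : Permutation′ (suc m)) →
  (∀ a b → KSucc m j a b ⇔ KSucc m k (π ⟨$⟩ʳ a) (π ⟨$⟩ʳ b)) → Dstar k (suc m) ≡ Dstar j (suc m)
Dstar-resp-permutation m j k π KSucc-π = begin
  Dstar k (suc m)
    ≡⟨ count-allFuns-∘ π (λ p → isPerm? (suc m) p ×-dec noCircSucc? m k p) resp ⟩
  length (filter (λ p → isPerm? (suc m) (σ ∘ p) ×-dec noCircSucc? m k (σ ∘ p)) (allFuns (suc m) (suc m)))
    ≡⟨ cong length (filter-≐ _ _ (unscaled , scaled) (allFuns (suc m) (suc m))) ⟩
  Dstar j (suc m)
    ∎
  where
  open ≡-Reasoning
  σ : Fin (suc m) → Fin (suc m)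
  σ = π ⟨$⟩ʳ_
  resp : (λ p → IsPerm (suc m) p × NoCircSucc m k p) Respects _≗_
  resp p≗q (perm , no-succ) = IsPerm-resp-≗ p≗q perm , NoCircSucc-resp-≗ p≗q no-succ
  unscaled : ∀ {p} → IsPerm (suc m) (σ ∘ p) × NoCircSucc m k (σ ∘ p) → IsPerm (suc m) p × NoCircSucc m j p
  unscaled {p} (perm , no-succ) = Equivalence.from (IsPerm-∘-⇔ π) perm ,
    NoCircSucc-transfer (λ {x y} → Equivalence.to (KSucc-π (p x) (p y))) no-succ
  scaled : ∀ {p} → IsPerm (suc m) p × NoCircSucc m j p → IsPerm (suc m) (σ ∘ p) × NoCircSucc m k (σ ∘ p)
  scaled {p} (perm , no-succ) = Equivalence.to (IsPerm-∘-⇔ π) perm ,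
    NoCircSucc-transfer (λ {x y} → Equivalence.from (KSucc-π (p x) (p y))) no-succ

Dstar-coprime : ∀ n k → gcd n k ≡ 1 → Dstar k n ≡ Dstar 1 n
Dstar-coprime zero    k _ = refl
Dstar-coprime (suc m) k gcd≡1 with modular-inverse (suc m) k gcd≡1
... | k' , k'k≡1 = Dstar-resp-permutation m 1 k (scale-permutation k k' k'k≡1) (KSucc-scale-⇔ k k' k'k≡1)

proposition2p6 : (n k : ℕ) → 3 ≤ n → 1 ≤ k → k < n → gcd n k ≡ 1 →
    Dstar k n ≡ Dstar 1 n
proposition2p6 n k _ _ _ = Dstar-coprime n k
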